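{- In the standing setup of the context, every small vertex that is not adjacent to any small vertex is smaller than $u_2$.
   Context: Loop-free multigraph: finite undirected graph without loops, multiple edges between distinct vertices allowed. The type of an edge joining $u,v$ is $\{u,v\}$; its multiplicity is the number of edges of that type; an edge/type is simple if its multiplicity is one and non-simple if at least two; a graph is simple if all edges are simple. Two vertices are adjacent if there is at least one edge between them. Double edge swap $(a_1,a_2)(a_3,a_4)$: remove two distinct edges of types $\{a_1,a_2\},\{a_3,a_4\}$ and add edges of types $\{a_2,a_3\},\{a_4,a_1\}$; admissible if the removed edges share no endpoint and not both are simple. Orders: fix finite $V$ and $d:V\to\mathbb{N}$, and a total order $<$ on $V$ with $d(u)<d(v)\Rightarrow u<v$. For $u_1>u_2$, $v_1>v_2$ set $\{u_1,u_2\}\le\{v_1,v_2\}$ iff $u_1<v_1$ or ($u_1=v_1$ and $u_2\le v_2$). For loop-free multigraphs on $V$ with degrees $d$: $G'<G$ iff $G$ is not simple and either the maximal non-simple type of $G$ is larger than all non-simple types of $G'$, or the maximal non-simple types of $G'$ and $G$ coincide and its multiplicity is strictly larger in $G$ than in $G'$. Standing setup: $G$ is a non-simple loop-free multigraph on $V$ with $\deg_G v=d(v)$ for all $v$, such that no finite sequence of admissible double edge swaps transforms $G$ into a graph $G'$ with $G'<G$. Let $\{u_1,u_2\}$, $u_1>u_2$, be the maximal non-simple type of $G$. Vertices other than $u_1,u_2$ are ordinary. For $i=1,2$, $V_i$ is the set of ordinary vertices adjacent to $u_i$ and $\overline{V_i}$ the set of ordinary vertices not adjacent to $u_i$. An ordinary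 vertex is small if it is smaller than $u_1$ and large if it is larger than $u_1$. -}

module Defs where

open import Data.Nat using (ℕ; zero; suc; _+_; _≤_)
open import Data.Fin using (Fin; _<_; _≟_)
import Data.Fin as F
open import Data.Product using (Σ; _×_; ∃; ∃-syntax)
open import Data.Sum using (_⊎_)
open import Data.Bool using (if_then_else_; _∧_; _∨_)
open import Relation.Nullary using (¬_; does)
open import Relation.Binary.PropositionalEquality using (_≡_; _≢_)
open import Relation.Binary.Construct.Closure.ReflexiveTransitive using (Star)

-- Vertex set V = Fin n; the total order < on V is the standard order on Fin n.

sumFin : ∀ {n} → (Fin n → ℕ) → ℕ
sumFin {zero}  f = 0
sumFin {suc n} f = f F.zero + sumFin (λ i → f (F.suc i))

record Multigraph (n : ℕ) : Set where
  field
    mult     : Fin n → Fin n → ℕ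
    symm     : ∀ x y → mult x y ≡ mult y x
    loopFree : ∀ x → mult x x ≡ 0
open Multigraph public

deg : ∀ {n} → Multigraph n → Fin n → ℕ
deg G v = sumFin (λ w → mult G v w)

Adjacent : ∀ {n} → Multigraph n → Fin n → Fin n → Set
Adjacent G u v = 1 ≤ mult G u v

IsSimple : ∀ {n} → Multigraph n → Set
IsSimple G = ∀ x y → mult G x y ≤ 1

-- A type {hi,lo} with hi > lo is represented by the ordered pair (hi , lo).
-- It is non-simple in G if its multiplicity is at least two.
NonSimpleType : ∀ {n} → Multigraph n → Fin n → Fin n → Set
NonSimpleType G hi lo = lo < hi × 2 ≤ mult G hi lo

_<ᵗ_ : ∀ {n} → (Fin n × Fin n) → (Fin n × Fin n) → Set
(u1 Data.Product., u2) <ᵗ (v1 Data.Product., v2) = u1 < v1 ⊎ (u1 ≡ v1 × u2 < v2)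

_≤ᵗ_ : ∀ {n} → (Fin n × Fin n) → (Fin n × Fin n) → Set
(u1 Data.Product., u2) ≤ᵗ (v1 Data.Product., v2) = u1 < v1 ⊎ (u1 ≡ v1 × u2 F.≤ v2)

IsMaxNonSimple : ∀ {n} → Multigraph n → Fin n → Fin n → Set
IsMaxNonSimple G hi lo =
  NonSimpleType G hi lo ×
  (∀ x1 x2 → NonSimpleType G x1 x2 → (x1 Data.Product., x2) ≤ᵗ (hi Data.Product., lo))

_<ᴳ_ : ∀ {n} → Multigraph n → Multigraph n → Set
G' <ᴳ G = ∃[ hi ] ∃[ lo ] (IsMaxNonSimple G hi lo ×
  ( (∀ x1 x2 → NonSimpleType G' x1 x2 →
        (x1 Data.Product., x2) <ᵗ (hi Data.Product., lo))
  ⊎ (IsMaxNonSimple G' hi lo × mult G' hi lo Data.Nat.< mult G hi lo)))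

ind : ∀ {n} → Fin n → Fin n → Fin n → Fin n → ℕ
ind a b x y =
  if (does (x ≟ a) ∧ does (y ≟ b)) ∨ (does (x ≟ b) ∧ does (y ≟ a)) then 1 else 0

-- An admissible double edge swap (a1,a2)(a3,a4) transforming G into H:
-- remove an edge of type {a1,a2} and one of type {a3,a4} (sharing no endpoint,
-- not both simple) and add edges of types {a2,a3} and {a4,a1}.
AdmissibleSwap : ∀ {n} → Multigraph n → Multigraph n → Set
AdmissibleSwap {n} G H = Σ (Fin n) λ a1 → Σ (Fin n) λ a2 → Σ (Fin n) λ a3 → Σ (Fin n) λ a4 →
  (a1 ≢ a2 × a1 ≢ a3 × a1 ≢ a4 × a2 ≢ a3 × a2 ≢ a4 × a3 ≢ a4) ×
  1 ≤ mult G a1 a2 × 1 ≤ mult G a3 a4 ×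
  (2 ≤ mult G a1 a2 ⊎ 2 ≤ mult G a3 a4) ×
  (∀ x y → mult H x y + ind a1 a2 x y + ind a3 a4 x y
         ≡ mult G x y + ind a2 a3 x y + ind a4 a1 x y)

Reachable : ∀ {n} → Multigraph n → Multigraph n → Set
Reachable = Star AdmissibleSwap

Ordinary : ∀ {n} → Fin n → Fin n → Fin n → Set
Ordinary u1 u2 v = v ≢ u1 × v ≢ u2

Small : ∀ {n} → Fin n → Fin n → Fin n → Set
Small u1 u2 v = Ordinary u1 u2 v × v < u1

-- Minimality of G forbids the swap (u1,u2)(a,b) whenever a, b are adjacent ordinary
-- vertices with a not adjacent to u2 and b not adjacent to u1: it lowers the
-- multiplicity of {u1,u2} and creates only simple types. Hence every large vertex x is
-- adjacent to u2, for otherwise every ordinary neighbour of x is a neighbour of u1, the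
-- edges at x are simple while {u1,u2} is not, and deg x < deg u1 contradicts x > u1.
-- Likewise, if a small vertex v without small neighbours were larger than u2, all
-- ordinary neighbours of v would be large, hence simple and adjacent to u2, the type
-- {u1,v} would be simple, and deg v < deg u2 would contradict v > u2.
module Submission where

open import Defs
open import Data.Nat using (ℕ)
import Data.Nat
open import Data.Fin using (Fin; _<_)
open import Relation.Nullary using (¬_)
open import Relation.Binary.PropositionalEquality using (_≡_)

open import Data.Nat as ℕ using (zero; suc; _+_; _∸_; _≤_; z≤n; s≤s; z<s)
open import Data.Nat.Properties
  using (≤-reflexive; ≤-trans; <⇒≤; ≤-<-trans; ≤-pred; ≮⇒≥; ≰⇒>; 1+n≰n; _≤?_;
         +-assoc; +-identityʳ; +-mono-≤; +-mono-<-≤; +-monoˡ-<; m≤m+n; m≤n+m;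
         m∸n≤m; m∸n+n≡m; ∸-monoʳ-<; +-commutativeSemigroup; module ≤-Reasoning)
open import Algebra.Properties.CommutativeSemigroup +-commutativeSemigroup using (x∙yz≈y∙xz)
open import Data.Fin as F using (_≟_)
open import Data.Fin.Properties using (<-cmp; <-asym; <-trans; <-irrefl; <⇒≢; ≤∧≢⇒<)
open import Data.Bool using (if_then_else_)
open import Data.Product using (_×_; _,_; proj₁; proj₂)
open import Data.Sum using (_⊎_; inj₁; inj₂)
open import Data.Empty using (⊥-elim)
open import Function using (_∘_)
open import Relation.Nullary using (Dec; does; yes; no)
open import Relation.Nullary.Decidable using (_×-dec_; _⊎-dec_; dec-true; dec-false)
open import Relation.Binary.Definitions using (tri<; tri≈; tri>)
open import Relation.Binary.PropositionalEquality
  using (_≢_; refl; sym; trans; cong; cong₂; subst; subst₂; ≢-sym; module ≡-Reasoning)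
open import Relation.Binary.Construct.Closure.ReflexiveTransitive using (_◅_; ε)

private
  variable
    n : ℕ

zeroAt : Fin n → (Fin n → ℕ) → Fin n → ℕ
zeroAt a f y = if does (y ≟ a) then 0 else f y

zeroAt-≢ : ∀ {a y} (f : Fin n → ℕ) → y ≢ a → zeroAt a f y ≡ f y
zeroAt-≢ {a = a} {y} f y≢a with y ≟ a
... | yes y≡a = ⊥-elim (y≢a y≡a)
... | no _    = refl

zeroAt₃-mono : ∀ {a b c} (f g : Fin n → ℕ) →
  (∀ y → y ≢ a → y ≢ b → y ≢ c → f y ≤ g y) →
  ∀ y → zeroAt c (zeroAt b (zeroAt a f)) y ≤ zeroAt c (zeroAt b (zeroAt a g)) y
zeroAt₃-mono {a = a} {b} {c} f g f≤g y with y ≟ c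
... | yes _ = z≤n
... | no y≢c with y ≟ b
...   | yes _ = z≤n
...   | no y≢b with y ≟ a
...     | yes _   = z≤n
...     | no y≢a  = f≤g y y≢a y≢b y≢c

sumFin-mono : (f g : Fin n → ℕ) → (∀ y → f y ≤ g y) → sumFin f ≤ sumFin g
sumFin-mono {zero}  f g f≤g = z≤n
sumFin-mono {suc n} f g f≤g =
  +-mono-≤ (f≤g F.zero) (sumFin-mono (λ i → f (F.suc i)) (λ i → g (F.suc i)) (λ i → f≤g (F.suc i)))

sumFin-split : (f : Fin n → ℕ) (a : Fin n) → sumFin f ≡ f a + sumFin (zeroAt a f)
sumFin-split {suc n} f F.zero    = refl
sumFin-split {suc n} f (F.suc a) = begin
  f₀ + sumFin f₊                              ≡⟨ cong (f₀ +_) (sumFin-split f₊ a) ⟩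
  f₀ + (f₊ a + sumFin (zeroAt a f₊))          ≡⟨ x∙yz≈y∙xz f₀ (f₊ a) _ ⟩
  f₊ a + (f₀ + sumFin (zeroAt a f₊))          ∎
  where
  open ≡-Reasoning
  f₀ = f F.zero
  f₊ = λ i → f (F.suc i)

sumFin-split₃ : ∀ {a b c} (f : Fin n → ℕ) → b ≢ a → c ≢ a → c ≢ b →
  sumFin f ≡ f a + f b + f c + sumFin (zeroAt c (zeroAt b (zeroAt a f)))
sumFin-split₃ {a = a} {b} {c} f b≢a c≢a c≢b = begin
  sumFin f                                      ≡⟨ sumFin-split f a ⟩
  f a + sumFin f₁                               ≡⟨ cong (f a +_) (sumFin-split f₁ b) ⟩
  f a + (f₁ b + sumFin f₂)                      ≡⟨ cong (λ z → f a + (f₁ b + z)) (sumFin-split f₂ c) ⟩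
  f a + (f₁ b + (f₂ c + sumFin f₃))             ≡⟨ cong₂ (λ s t → f a + (s + (t + sumFin f₃)))
                                                     (zeroAt-≢ f b≢a)
                                                     (trans (zeroAt-≢ f₁ c≢b) (zeroAt-≢ f c≢a)) ⟩
  f a + (f b + (f c + sumFin f₃))               ≡⟨ sym (+-assoc (f a) (f b) _) ⟩
  f a + f b + (f c + sumFin f₃)                 ≡⟨ sym (+-assoc (f a + f b) (f c) _) ⟩
  f a + f b + f c + sumFin f₃                   ∎
  where
  open ≡-Reasoning
  f₁ = zeroAt a f
  f₂ = zeroAt b f₁
  f₃ = zeroAt c f₂

sumFin-<-except₃ : ∀ {a b c} (f g : Fin n → ℕ) → b ≢ a → c ≢ a → c ≢ b →
  (∀ y → y ≢ a → y ≢ b → y ≢ c → f y ≤ g y) →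
  f a + f b + f c ℕ.< g a + g b + g c → sumFin f ℕ.< sumFin g
sumFin-<-except₃ f g b≢a c≢a c≢b f≤g f<g = subst₂ ℕ._<_
  (sym (sumFin-split₃ f b≢a c≢a c≢b)) (sym (sumFin-split₃ g b≢a c≢a c≢b))
  (+-mono-<-≤ f<g (sumFin-mono _ _ (zeroAt₃-mono f g f≤g)))

SameType : Fin n → Fin n → Fin n → Fin n → Set
SameType a b x y = (x ≡ a × y ≡ b) ⊎ (x ≡ b × y ≡ a)

sameType? : (a b x y : Fin n) → Dec (SameType a b x y)
sameType? a b x y = (x ≟ a ×-dec y ≟ b) ⊎-dec (x ≟ b ×-dec y ≟ a)

ind-≡1 : ∀ {a b x y : Fin n} → SameType a b x y → ind a b x y ≡ 1
ind-≡1 {a = a} {b} {x} {y} t = cong (if_then 1 else 0) (dec-true (sameType? a b x y) t)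

ind-≡0 : ∀ {a b x y : Fin n} → ¬ SameType a b x y → ind a b x y ≡ 0
ind-≡0 {a = a} {b} {x} {y} ¬t = cong (if_then 1 else 0) (dec-false (sameType? a b x y) ¬t)

SameType-sym : ∀ {a b x y : Fin n} → SameType a b x y → SameType a b y x
SameType-sym (inj₁ (x≡a , y≡b)) = inj₂ (y≡b , x≡a)
SameType-sym (inj₂ (x≡b , y≡a)) = inj₁ (y≡a , x≡b)

SameType-disjoint : ∀ {a b c d x y : Fin n} → a ≢ c → a ≢ d →
  SameType a b x y → ¬ SameType c d x y
SameType-disjoint a≢c a≢d (inj₁ (refl , refl)) (inj₁ (refl , refl)) = a≢c refl
SameType-disjoint a≢c a≢d (inj₁ (refl , refl)) (inj₂ (refl , refl)) = a≢d refl
SameType-disjoint a≢c a≢d (inj₂ (refl , refl)) (inj₁ (refl , refl)) = a≢d refl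
SameType-disjoint a≢c a≢d (inj₂ (refl , refl)) (inj₂ (refl , refl)) = a≢c refl

ind-sym : (a b x y : Fin n) → ind a b x y ≡ ind a b y x
ind-sym a b x y with sameType? a b x y
... | yes t  = trans (ind-≡1 t) (sym (ind-≡1 (SameType-sym t)))
... | no ¬t  = trans (ind-≡0 ¬t) (sym (ind-≡0 (¬t ∘ SameType-sym)))

ind-diagonal : ∀ {a b} (x : Fin n) → a ≢ b → ind a b x x ≡ 0
ind-diagonal {a = a} {b} x a≢b = ind-≡0 {a = a} {b} {x} {x} λ
  { (inj₁ (refl , refl)) → a≢b refl
  ; (inj₂ (refl , refl)) → a≢b refl }

mult-SameType : (G : Multigraph n) {a b x y : Fin n} → SameType a b x y → mult G x y ≡ mult G a b
mult-SameType G (inj₁ (refl , refl)) = refl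
mult-SameType G (inj₂ (refl , refl)) = symm G _ _

<ᵗ⇒≱ᵗ : ∀ {s₁ s₂ t₁ t₂ : Fin n} → (s₁ , s₂) <ᵗ (t₁ , t₂) → ¬ ((t₁ , t₂) ≤ᵗ (s₁ , s₂))
<ᵗ⇒≱ᵗ (inj₁ s₁<t₁)        (inj₁ t₁<s₁)        = <-asym s₁<t₁ t₁<s₁
<ᵗ⇒≱ᵗ (inj₁ s₁<t₁)        (inj₂ (refl , _))   = <-irrefl refl s₁<t₁
<ᵗ⇒≱ᵗ (inj₂ (refl , _))   (inj₁ t₁<s₁)        = <-irrefl refl t₁<s₁
<ᵗ⇒≱ᵗ (inj₂ (_ , s₂<t₂))  (inj₂ (_ , t₂≤s₂))  = <-irrefl refl (≤-<-trans t₂≤s₂ s₂<t₂)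

<ᴳ-by-max-decrease : ∀ {G H : Multigraph n} {a b} → IsMaxNonSimple G a b →
  (∀ x y → NonSimpleType H x y → NonSimpleType G x y) →
  mult H a b ℕ.< mult G a b → H <ᴳ G
<ᴳ-by-max-decrease {H = H} {a} {b} max@((b<a , _) , below) H⊆G H<G with 2 ≤? mult H a b
... | yes 2≤H = a , b , max , inj₂ (((b<a , 2≤H) , λ x y ns → below x y (H⊆G x y ns)) , H<G)
... | no 2≰H  = a , b , max , inj₁ λ x y ns → strict x y ns (below x y (H⊆G x y ns))
  where
  strict : ∀ x y → NonSimpleType H x y → (x , y) ≤ᵗ (a , b) → (x , y) <ᵗ (a , b)
  strict x y ns (inj₁ x<a)          = inj₁ x<a
  strict x y ns (inj₂ (refl , y≤b)) = inj₂ (refl , ≤∧≢⇒< y≤b λ { refl → 2≰H (proj₂ ns) })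

module DoubleEdgeSwap (G : Multigraph n) (a1 a2 a3 a4 : Fin n)
  (a1≢a2 : a1 ≢ a2) (a1≢a3 : a1 ≢ a3) (a1≢a4 : a1 ≢ a4)
  (a2≢a3 : a2 ≢ a3) (a2≢a4 : a2 ≢ a4) (a3≢a4 : a3 ≢ a4)
  (nonSimple₁₂ : 2 ≤ mult G a1 a2) (edge₃₄ : 1 ≤ mult G a3 a4)
  (absent₂₃ : mult G a2 a3 ≡ 0) (absent₄₁ : mult G a4 a1 ≡ 0) where

  edge₁₂ : 1 ≤ mult G a1 a2
  edge₁₂ = <⇒≤ nonSimple₁₂

  added removed : Fin n → Fin n → ℕ
  added   x y = mult G x y + ind a2 a3 x y + ind a4 a1 x y
  removed x y = ind a1 a2 x y + ind a3 a4 x y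

  mult≤added : ∀ x y → mult G x y ≤ added x y
  mult≤added x y = ≤-trans (m≤m+n _ (ind a2 a3 x y)) (m≤m+n _ (ind a4 a1 x y))

  removed≤added : ∀ x y → removed x y ≤ added x y
  removed≤added x y with sameType? a1 a2 x y | sameType? a3 a4 x y
  ... | yes t | _ = begin
    ind a1 a2 x y + ind a3 a4 x y  ≡⟨ cong₂ _+_ (ind-≡1 t) (ind-≡0 (SameType-disjoint a1≢a3 a1≢a4 t)) ⟩
    1                              ≤⟨ edge₁₂ ⟩
    mult G a1 a2                   ≡⟨ sym (mult-SameType G t) ⟩
    mult G x y                     ≤⟨ mult≤added x y ⟩
    added x y                      ∎
    where open ≤-Reasoning
  ... | no ¬t | yes t = begin
    ind a1 a2 x y + ind a3 a4 x y  ≡⟨ cong₂ _+_ (ind-≡0 ¬t) (ind-≡1 t) ⟩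
    1                              ≤⟨ edge₃₄ ⟩
    mult G a3 a4                   ≡⟨ sym (mult-SameType G t) ⟩
    mult G x y                     ≤⟨ mult≤added x y ⟩
    added x y                      ∎
    where open ≤-Reasoning
  ... | no ¬t | no ¬t′ = ≤-trans (≤-reflexive (cong₂ _+_ (ind-≡0 ¬t) (ind-≡0 ¬t′))) z≤n

  swapped : Multigraph n
  mult swapped x y = added x y ∸ removed x y
  symm swapped x y
    rewrite symm G x y | ind-sym a2 a3 x y | ind-sym a4 a1 x y
          | ind-sym a1 a2 x y | ind-sym a3 a4 x y = refl
  loopFree swapped x
    rewrite loopFree G x | ind-diagonal x a2≢a3 | ind-diagonal x (≢-sym a1≢a4)
          | ind-diagonal x a1≢a2 | ind-diagonal x a3≢a4 = refl

  admissible : AdmissibleSwap G swapped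
  admissible = a1 , a2 , a3 , a4 , (a1≢a2 , a1≢a3 , a1≢a4 , a2≢a3 , a2≢a4 , a3≢a4) ,
    edge₁₂ , edge₃₄ , inj₁ nonSimple₁₂ ,
    λ x y → trans (+-assoc (mult swapped x y) _ _) (m∸n+n≡m (removed≤added x y))

  added-elsewhere : ∀ {x y} → ¬ SameType a2 a3 x y → ¬ SameType a4 a1 x y → added x y ≡ mult G x y
  added-elsewhere {x} {y} ¬t ¬t′ rewrite ind-≡0 ¬t | ind-≡0 ¬t′ = trans (+-identityʳ _) (+-identityʳ _)

  added-≤ : ∀ x y → added x y ≤ mult G x y ⊎ added x y ≡ 1
  added-≤ x y with sameType? a2 a3 x y | sameType? a4 a1 x y
  ... | yes t | _
    rewrite mult-SameType G t | absent₂₃ | ind-≡1 t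
          | ind-≡0 (SameType-disjoint a2≢a4 (≢-sym a1≢a2) t) = inj₂ refl
  ... | no ¬t | yes t
    rewrite mult-SameType G t | absent₄₁ | ind-≡0 ¬t | ind-≡1 t = inj₂ refl
  ... | no ¬t | no ¬t′ = inj₁ (≤-reflexive (added-elsewhere ¬t ¬t′))

  swapped≤added : ∀ x y → mult swapped x y ≤ added x y
  swapped≤added x y = m∸n≤m (added x y) (removed x y)

  swapped-nonSimple : ∀ x y → NonSimpleType swapped x y → NonSimpleType G x y
  swapped-nonSimple x y (y<x , 2≤swapped) with added-≤ x y
  ... | inj₁ added≤G = y<x , ≤-trans 2≤swapped (≤-trans (swapped≤added x y) added≤G)
  ... | inj₂ added≡1 = ⊥-elim (1+n≰n (≤-trans 2≤swapped (subst (mult swapped x y ≤_) added≡1 (swapped≤added x y))))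

  swapped₁₂-< : mult swapped a1 a2 ℕ.< mult G a1 a2
  swapped₁₂-< = subst₂ (λ s t → s ∸ t ℕ.< mult G a1 a2)
    (sym (added-elsewhere (SameType-disjoint a1≢a2 a1≢a3 same₁₂)
                          (SameType-disjoint a2≢a4 (≢-sym a1≢a2) same₂₁)))
    (sym (cong₂ _+_ (ind-≡1 same₁₂) (ind-≡0 (SameType-disjoint a1≢a3 a1≢a4 same₁₂))))
    (∸-monoʳ-< z<s edge₁₂)
    where
    same₁₂ : SameType a1 a2 a1 a2
    same₁₂ = inj₁ (refl , refl)
    same₂₁ : SameType a2 a1 a1 a2
    same₂₁ = inj₂ (refl , refl)

module StandingSetup (d : Fin n → ℕ) (d-monotone : ∀ u v → d u ℕ.< d v → u < v)
  (G : Multigraph n) (deg≡d : ∀ v → deg G v ≡ d v)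
  (minimal : ∀ G′ → Reachable G G′ → ¬ (G′ <ᴳ G))
  (u1 u2 : Fin n) (max : IsMaxNonSimple G u1 u2) where

  u2<u1 : u2 < u1
  u2<u1 = proj₁ (proj₁ max)

  nonSimple₁₂ : 2 ≤ mult G u1 u2
  nonSimple₁₂ = proj₂ (proj₁ max)

  deg-<⇒< : ∀ {u v} → deg G u ℕ.< deg G v → u < v
  deg-<⇒< {u} {v} = d-monotone u v ∘ subst₂ ℕ._<_ (deg≡d u) (deg≡d v)

  above-max-simple : ∀ {a b} → b < a → (u1 , u2) <ᵗ (a , b) → mult G a b ≤ 1
  above-max-simple {a} {b} b<a above with 2 ≤? mult G a b
  ... | no 2≰ab  = ≤-pred (≰⇒> 2≰ab)
  ... | yes 2≤ab = ⊥-elim (<ᵗ⇒≱ᵗ above (proj₂ max a b (b<a , 2≤ab)))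

  large-simple : ∀ {a b} → u1 < a → mult G a b ≤ 1
  large-simple {a} {b} u1<a with <-cmp a b
  ... | tri< a<b _ _ = subst (_≤ 1) (symm G b a) (above-max-simple a<b (inj₁ (<-trans u1<a a<b)))
  ... | tri≈ _ refl _ = ≤-trans (≤-reflexive (loopFree G a)) z≤n
  ... | tri> _ _ b<a = above-max-simple b<a (inj₁ u1<a)

  swap-obstructed : ∀ {a b} → Ordinary u1 u2 a → Ordinary u1 u2 b → a ≢ b →
    mult G u2 a ≡ 0 → mult G b u1 ≡ 0 → mult G a b ≡ 0
  swap-obstructed {a} {b} (a≢u1 , a≢u2) (b≢u1 , b≢u2) a≢b absent₂₃ absent₄₁ with mult G a b in ab
  ... | zero  = refl
  ... | suc _ = ⊥-elim (minimal swapped (admissible ◅ ε)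
                  (<ᴳ-by-max-decrease {G = G} {swapped} max swapped-nonSimple swapped₁₂-<))
    where
    open DoubleEdgeSwap G u1 u2 a b (≢-sym (<⇒≢ u2<u1)) (≢-sym a≢u1) (≢-sym b≢u1)
      (≢-sym a≢u2) (≢-sym b≢u2) a≢b nonSimple₁₂ (subst (1 ≤_) (sym ab) (s≤s z≤n)) absent₂₃ absent₄₁

  nonadjacent-u2⇒deg<deg-u1 : ∀ {x} → u1 < x → mult G u2 x ≡ 0 → deg G x ℕ.< deg G u1
  nonadjacent-u2⇒deg<deg-u1 {x} u1<x absent = sumFin-<-except₃ (mult G x) (mult G u1)
    (<⇒≢ u2<u1) x≢u1 x≢u2 dominated exceptional
    where
    x≢u1 : x ≢ u1
    x≢u1 = ≢-sym (<⇒≢ u1<x)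
    x≢u2 : x ≢ u2
    x≢u2 = ≢-sym (<⇒≢ (<-trans u2<u1 u1<x))
    dominated : ∀ y → y ≢ u1 → y ≢ u2 → y ≢ x → mult G x y ≤ mult G u1 y
    dominated y y≢u1 y≢u2 y≢x with mult G u1 y in u1y
    ... | zero  = ≤-reflexive (swap-obstructed (x≢u1 , x≢u2) (y≢u1 , y≢u2) (≢-sym y≢x)
                    absent (trans (symm G y u1) u1y))
    ... | suc _ = ≤-trans (large-simple u1<x) (s≤s z≤n)
    exceptional : mult G x u1 + mult G x u2 + mult G x x ℕ.< mult G u1 u1 + mult G u1 u2 + mult G u1 x
    exceptional = begin-strict
      mult G x u1 + mult G x u2 + mult G x x
        ≤⟨ +-mono-≤ (+-mono-≤ (large-simple u1<x) (≤-reflexive (trans (symm G x u2) absent)))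
                    (≤-reflexive (loopFree G x)) ⟩
      1 + 0 + 0                               <⟨ nonSimple₁₂ ⟩
      mult G u1 u2                            ≤⟨ m≤n+m _ (mult G u1 u1) ⟩
      mult G u1 u1 + mult G u1 u2             ≤⟨ m≤m+n _ (mult G u1 x) ⟩
      mult G u1 u1 + mult G u1 u2 + mult G u1 x ∎
      where open ≤-Reasoning

  large⇒adjacent-u2 : ∀ {x} → u1 < x → Adjacent G u2 x
  large⇒adjacent-u2 {x} u1<x with mult G u2 x in u2x
  ... | zero  = ⊥-elim (<-asym u1<x (deg-<⇒< (nonadjacent-u2⇒deg<deg-u1 u1<x u2x)))
  ... | suc _ = s≤s z≤n

  isolated-small⇒deg<deg-u2 : ∀ {v} → Small u1 u2 v →
    (∀ w → Small u1 u2 w → ¬ Adjacent G v w) → u2 < v → deg G v ℕ.< deg G u2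
  isolated-small⇒deg<deg-u2 {v} ((v≢u1 , v≢u2) , v<u1) isolated u2<v =
    sumFin-<-except₃ (mult G v) (mult G u2) (<⇒≢ u2<u1) v≢u1 v≢u2 dominated exceptional
    where
    dominated : ∀ y → y ≢ u1 → y ≢ u2 → y ≢ v → mult G v y ≤ mult G u2 y
    dominated y y≢u1 y≢u2 y≢v with <-cmp y u1
    ... | tri< y<u1 _ _ = ≤-trans (≮⇒≥ (isolated y ((y≢u1 , y≢u2) , y<u1))) z≤n
    ... | tri≈ _ y≡u1 _ = ⊥-elim (y≢u1 y≡u1)
    ... | tri> _ _ u1<y =
      ≤-trans (subst (_≤ 1) (symm G y v) (large-simple u1<y)) (large⇒adjacent-u2 u1<y)
    m = mult G u2 v
    exceptional : mult G v u1 + mult G v u2 + mult G v v ℕ.< mult G u2 u1 + mult G u2 u2 + m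
    exceptional = begin-strict
      mult G v u1 + mult G v u2 + mult G v v
        ≤⟨ +-mono-≤ (+-mono-≤ (subst (_≤ 1) (symm G u1 v) (above-max-simple v<u1 (inj₂ (refl , u2<v))))
                              (≤-reflexive (symm G v u2)))
                    (≤-reflexive (loopFree G v)) ⟩
      1 + m + 0                               ≡⟨ +-identityʳ (1 + m) ⟩
      1 + m                                   <⟨ +-monoˡ-< m (subst (2 ≤_) (symm G u1 u2) nonSimple₁₂) ⟩
      mult G u2 u1 + m                        ≡⟨ cong (λ z → z + m) (sym (+-identityʳ _)) ⟩
      mult G u2 u1 + 0 + m                    ≡⟨ cong (λ z → mult G u2 u1 + z + m) (sym (loopFree G u2)) ⟩
      mult G u2 u1 + mult G u2 u2 + m         ∎
      where open ≤-Reasoning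

-- The hypothesis ¬ IsSimple G is implied by IsMaxNonSimple G u1 u2.
lemma5p7 : (n : ℕ) (d : Fin n → ℕ)
    → (∀ u v → d u Data.Nat.< d v → u < v)
    → (G : Multigraph n)
    → (∀ v → deg G v ≡ d v)
    → ¬ IsSimple G
    → (∀ G' → Reachable G G' → ¬ (G' <ᴳ G))
    → (u1 u2 : Fin n)
    → IsMaxNonSimple G u1 u2
    → (v : Fin n)
    → Small u1 u2 v
    → (∀ w → Small u1 u2 w → ¬ Adjacent G v w)
    → v < u2
lemma5p7 n d d-monotone G deg≡d _ minimal u1 u2 max v small@((_ , v≢u2) , _) isolated
  with <-cmp v u2
... | tri< v<u2 _ _ = v<u2
... | tri≈ _ v≡u2 _ = ⊥-elim (v≢u2 v≡u2)
... | tri> _ _ u2<v = ⊥-elim (<-asym u2<v (deg-<⇒< (isolated-small⇒deg<deg-u2 small isolated u2<v)))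
  where open StandingSetup d d-monotone G deg≡d minimal u1 u2 max
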